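{- Let $\mathcal{C}$ be a category equipped, for all objects $X,Y$, with a distinguished morphism $0_{X,Y}\in\mathcal{C}(X,Y)$, and let $(S,\pi_0,\pi_1,\sigma)$ be a pre-summability structure on $\mathcal{C}$. Let $f_0,f_1,g_0,g_1\in\mathcal{C}(X,Y)$ be such that $(f_0,f_1)$ is summable and $(g_0,g_1)$ is summable, and assume moreover that the two morphisms $\langle f_0,f_1\rangle,\ \langle g_0,g_1\rangle\in\mathcal{C}(X,SY)$ are summable. Then for each $i\in\{0,1\}$ the pair $(f_i,g_i)$ is summable, the pair $(f_0+g_0,\ f_1+g_1)$ is summable, and $$\langle f_0,f_1\rangle+\langle g_0,g_1\rangle=\langle f_0+g_0,\ f_1+g_1\rangle .$$
   Context: Standing setting: $\mathcal{C}$ is a model of linear logic (a Seely category) having zero morphisms $0_{X,Y}$ for all objects $X,Y$; only the category structure and the morphisms $0_{X,Y}$ enter the definitions below. A pre-summability structure on $\mathcal{C}$ is a tuple $(S,\pi_0,\pi_1,\sigma)$ where $S:\mathcal{C}\to\mathcal{C}$ is a functor with $S(0_{X,Y})=0_{SX,SY}$ for all $X,Y$; $\pi_0,\pi_1,\sigma$ are natural transformations $S\Rightarrow \mathrm{Id}$ (so $\pi_i,\sigma:SX\to X$); and $\pi_0,\pi_1$ are jointly monic: for $f,g\in\mathcal{C}(Z,SX)$, if $\pi_0\circ f=\pi_0\circ g$ and $\pi_1\circ f=\pi_1\circ g$ then $f=g$. Two morphisms $f_0,f_1\in\mathcal{C}(Z,X)$ are summable if there is $h\in\mathcal{C}(Z,SX)$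 with $\pi_0\circ h=f_0$ and $\pi_1\circ h=f_1$; such $h$ is then unique, is denoted $\langle f_0,f_1\rangle$ (the witness), and the sum is $f_0+f_1:=\sigma\circ\langle f_0,f_1\rangle$. This applies in particular with $X$ replaced by $SY$, giving the notion of summability and sum for morphisms $Z\to SY$. -}

module Defs where

open import Level using (Level; _⊔_; suc)
open import Relation.Binary.PropositionalEquality using (_≡_)
open import Data.Product using (Σ; _×_; proj₁)

record Category (o h : Level) : Set (suc (o ⊔ h)) where
  infixr 9 _∘_
  field
    Obj  : Set o
    Hom  : Obj → Obj → Set h
    id   : ∀ {X} → Hom X X
    _∘_  : ∀ {X Y Z} → Hom Y Z → Hom X Y → Hom X Z
    idˡ  : ∀ {X Y} (f : Hom X Y) → id ∘ f ≡ f
    idʳ  : ∀ {X Y} (f : Hom X Y) → f ∘ id ≡ f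
    assoc : ∀ {W X Y Z} (f : Hom Y Z) (g : Hom X Y) (k : Hom W X) →
            (f ∘ g) ∘ k ≡ f ∘ (g ∘ k)

record CategoryWithZeros (o h : Level) : Set (suc (o ⊔ h)) where
  field
    cat : Category o h
  open Category cat
  field
    zero : ∀ X Y → Hom X Y

record PreSummability {o h : Level} (𝒞 : CategoryWithZeros o h) : Set (o ⊔ h) where
  open CategoryWithZeros 𝒞
  open Category cat
  field
    S₀    : Obj → Obj
    S₁    : ∀ {X Y} → Hom X Y → Hom (S₀ X) (S₀ Y)
    S-id  : ∀ {X} → S₁ (id {X}) ≡ id
    S-∘   : ∀ {X Y Z} (f : Hom Y Z) (g : Hom X Y) → S₁ (f ∘ g) ≡ S₁ f ∘ S₁ g
    S-zero : ∀ X Y → S₁ (zero X Y) ≡ zero (S₀ X) (S₀ Y)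
    π₀ π₁ σ : ∀ X → Hom (S₀ X) X
    π₀-nat : ∀ {X Y} (f : Hom X Y) → f ∘ π₀ X ≡ π₀ Y ∘ S₁ f
    π₁-nat : ∀ {X Y} (f : Hom X Y) → f ∘ π₁ X ≡ π₁ Y ∘ S₁ f
    σ-nat  : ∀ {X Y} (f : Hom X Y) → f ∘ σ X ≡ σ Y ∘ S₁ f
    jointly-monic : ∀ {Z X} (f g : Hom Z (S₀ X)) →
      π₀ X ∘ f ≡ π₀ X ∘ g → π₁ X ∘ f ≡ π₁ X ∘ g → f ≡ g

  Summable : ∀ {Z X} → Hom Z X → Hom Z X → Set h
  Summable {Z} {X} f₀ f₁ = Σ (Hom Z (S₀ X)) λ k → (π₀ X ∘ k ≡ f₀) × (π₁ X ∘ k ≡ f₁)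

  -- the witness ⟨f₀,f₁⟩ (unique by joint monicity)
  ⟨_⟩ : ∀ {Z X} {f₀ f₁ : Hom Z X} → Summable f₀ f₁ → Hom Z (S₀ X)
  ⟨ s ⟩ = proj₁ s

  sum : ∀ {Z X} {f₀ f₁ : Hom Z X} → Summable f₀ f₁ → Hom Z X
  sum {X = X} s = σ X ∘ ⟨ s ⟩

{-# OPTIONS --safe #-}
module Submission where

open import Defs
open import Level using (Level)
open import Relation.Binary.PropositionalEquality using (_≡_; refl; sym; trans; cong; module ≡-Reasoning)
open import Data.Product using (Σ; _,_)

-- Summability is stable under postcomposition, with witness S f ∘ ⟨u₀,u₁⟩ by naturality
-- of π₀ and π₁. Applying this to π₀ and π₁ splits ⟨⟨f₀,f₁⟩,⟨g₀,g₁⟩⟩ into witnesses for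
-- (f₀,g₀) and (f₁,g₁); naturality of σ identifies their sums with the two projections of
-- ⟨f₀,f₁⟩ + ⟨g₀,g₁⟩, which is therefore itself the witness of (f₀+g₀, f₁+g₁).

module PreSummabilityProperties {o h : Level} (𝒞 : CategoryWithZeros o h) (P : PreSummability 𝒞) where
  open CategoryWithZeros 𝒞
  open Category cat
  open PreSummability P

  private
    variable
      X Y Z : Obj

  Summable-resp-≡ : {u₀ u₁ v₀ v₁ : Hom Z X} → u₀ ≡ v₀ → u₁ ≡ v₁ →
                    Summable u₀ u₁ → Summable v₀ v₁
  Summable-resp-≡ u₀≡v₀ u₁≡v₁ (k , π₀k≡u₀ , π₁k≡u₁) = k , trans π₀k≡u₀ u₀≡v₀ , trans π₁k≡u₁ u₁≡v₁

  projections-summable : (k : Hom Z (S₀ X)) → Summable (π₀ X ∘ k) (π₁ X ∘ k)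
  projections-summable k = k , refl , refl

  ∘-natural : (τ : ∀ A → Hom (S₀ A) A) → (∀ {A B} (f : Hom A B) → f ∘ τ A ≡ τ B ∘ S₁ f) →
              (f : Hom X Y) (k : Hom Z (S₀ X)) → τ Y ∘ (S₁ f ∘ k) ≡ f ∘ (τ X ∘ k)
  ∘-natural τ τ-nat f k = begin
    τ _ ∘ (S₁ f ∘ k)   ≡⟨ sym (assoc _ _ _) ⟩
    (τ _ ∘ S₁ f) ∘ k   ≡⟨ cong (_∘ k) (sym (τ-nat f)) ⟩
    (f ∘ τ _) ∘ k      ≡⟨ assoc _ _ _ ⟩
    f ∘ (τ _ ∘ k)      ∎
    where open ≡-Reasoning

  ∘-summable : (f : Hom X Y) {u₀ u₁ : Hom Z X} →
               Summable u₀ u₁ → Summable (f ∘ u₀) (f ∘ u₁)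
  ∘-summable f (k , π₀k≡u₀ , π₁k≡u₁) =
    S₁ f ∘ k ,
    trans (∘-natural π₀ π₀-nat f k) (cong (f ∘_) π₀k≡u₀) ,
    trans (∘-natural π₁ π₁-nat f k) (cong (f ∘_) π₁k≡u₁)

  sum-∘ : (f : Hom X Y) {u₀ u₁ : Hom Z X} (s : Summable u₀ u₁) →
          sum (∘-summable f s) ≡ f ∘ sum s
  sum-∘ f (k , _ , _) = ∘-natural σ σ-nat f k

mainTheorem1 : {o h : Level} (𝒞 : CategoryWithZeros o h) (P : PreSummability 𝒞) →
    let open CategoryWithZeros 𝒞 in
    let open Category cat in
    let open PreSummability P in
    {X Y : Obj} (f₀ f₁ g₀ g₁ : Hom X Y) →
    (sf : Summable f₀ f₁) (sg : Summable g₀ g₁) →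
    (s : Summable ⟨ sf ⟩ ⟨ sg ⟩) →
    Σ (Summable f₀ g₀) λ s₀ → Σ (Summable f₁ g₁) λ s₁ →
      Σ (Summable (sum s₀) (sum s₁)) λ t → sum s ≡ ⟨ t ⟩
mainTheorem1 𝒞 P {Y = Y} f₀ f₁ g₀ g₁ (_ , π₀h≡f₀ , π₁h≡f₁) (_ , π₀k≡g₀ , π₁k≡g₁) s =
  s₀ , s₁ , t , refl
  where
  open CategoryWithZeros 𝒞
  open Category cat
  open PreSummability P
  open PreSummabilityProperties 𝒞 P

  s₀ : Summable f₀ g₀
  s₀ = Summable-resp-≡ π₀h≡f₀ π₀k≡g₀ (∘-summable (π₀ Y) s)

  s₁ : Summable f₁ g₁
  s₁ = Summable-resp-≡ π₁h≡f₁ π₁k≡g₁ (∘-summable (π₁ Y) s)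

  t : Summable (sum s₀) (sum s₁)
  t = Summable-resp-≡ (sym (sum-∘ (π₀ Y) s)) (sym (sum-∘ (π₁ Y) s)) (projections-summable (sum s))
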